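{- Let $r \geq 5$ and let $k$ be an integer with $0 \leq k \leq \frac{r-2}{3}$. Let $M$ be a simple binary matroid of rank $r$ with no coloops that has a $k$-loose element. Then $|E(M)| \leq 2^k(r-k+1)$.
   Context: For a matroid $M$ of rank $r$ and a non-negative integer $k$, an element $t$ of $M$ is called $k$-loose if every circuit of $M$ that contains $t$ has size greater than $r-k$. A binary matroid is one representable over $GF(2)$; a matroid is simple if it has no loops and no parallel pairs. -}

module Defs where

open import Data.Nat using (ℕ; zero; suc; _≤_; _<_; _∸_)
open import Data.Bool using (Bool; true; false; _xor_)
open import Data.Fin using (Fin)
import Data.Fin as F
open import Data.Fin.Subset using (Subset; _⊆_; _⊂_; _∈_; ∣_∣; Nonempty)
open import Data.Vec using (Vec; []; _∷_; replicate; zipWith)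
open import Data.Product using (Σ; ∃; _×_; _,_)
open import Relation.Binary.PropositionalEquality using (_≡_)
open import Relation.Nullary using (¬_)

-- GF(2) is modelled by Bool with xor as addition.
-- A binary matroid on ground set Fin m is given by a GF(2)-representation:
-- a matrix with n rows and m columns, i.e. a column map  Fin m → GF(2)^n.
BinRep : ℕ → ℕ → Set
BinRep n m = Fin m → Vec Bool n

zeroV : ∀ {n} → Vec Bool n
zeroV = replicate _ false

_⊕_ : ∀ {n} → Vec Bool n → Vec Bool n → Vec Bool n
_⊕_ = zipWith _xor_

colSum : ∀ {n m} → BinRep n m → Subset m → Vec Bool n
colSum {m = zero}  A []        = zeroV
colSum {m = suc m} A (true ∷ S)  = A F.zero ⊕ colSum (λ i → A (F.suc i)) S
colSum {m = suc m} A (false ∷ S) = colSum (λ i → A (F.suc i)) S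

-- A set X is dependent in the vector matroid M[A] iff its columns are
-- linearly dependent over GF(2), i.e. some nonempty subset sums to zero.
Dependent : ∀ {n m} → BinRep n m → Subset m → Set
Dependent A X = ∃ λ Y → Y ⊆ X × Nonempty Y × colSum A Y ≡ zeroV

Independent : ∀ {n m} → BinRep n m → Subset m → Set
Independent A X = ¬ Dependent A X

Circuit : ∀ {n m} → BinRep n m → Subset m → Set
Circuit A C = Dependent A C × (∀ Y → Y ⊂ C → Independent A Y)

Basis : ∀ {n m} → BinRep n m → Subset m → Set
Basis A B = Independent A B × (∀ X → B ⊂ X → Dependent A X)

-- rank of the matroid: size of a basis (all bases have equal size; we
-- require every basis to have size r and at least one basis to exist)
HasRank : ∀ {n m} → BinRep n m → ℕ → Set
HasRank A r = (∃ λ B → Basis A B) × (∀ B → Basis A B → ∣ B ∣ ≡ r)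

Loop : ∀ {n m} → BinRep n m → Fin m → Set
Loop A e = ∃ λ C → Circuit A C × e ∈ C × ∣ C ∣ ≡ 1

ParallelPair : ∀ {n m} → BinRep n m → Fin m → Fin m → Set
ParallelPair A e f = ¬ (e ≡ f) × (∃ λ C → Circuit A C × e ∈ C × f ∈ C × ∣ C ∣ ≡ 2)

Simple : ∀ {n m} → BinRep n m → Set
Simple A = (∀ e → ¬ Loop A e) × (∀ e f → ¬ ParallelPair A e f)

Coloop : ∀ {n m} → BinRep n m → Fin m → Set
Coloop A e = ∀ B → Basis A B → e ∈ B

KLoose : ∀ {n m} → BinRep n m → (r k : ℕ) → Fin m → Set
KLoose A r k t = ∀ C → Circuit A C → t ∈ C → r ∸ k < ∣ C ∣

-- Let t be the k-loose element. As t is not a coloop, A t is a sum of columns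
-- avoiding t; choose such a set X of minimum size. Minimality makes X ∪ {t} a
-- circuit, hence ∣X∣ ≥ r − k, and makes X independent, so the map
-- (e , Z) ↦ A e ⊕ ΣZ on columns e and subsets Z ⊆ X, which lands in the
-- 2^r-element column space, is injective in Z for fixed e. Its fibres are cosets of
-- the span of X, and each contains at most ∣X∣ + 1 columns: the span itself only
-- contains columns of X ∪ {t}, and in any other coset, for a fixed member e₁, the
-- columns e give supports of A e₁ ⊕ A e in X of size 1 or 2 whose pairwise
-- symmetric differences have size at most 2 (again by minimality), i.e. an
-- intersecting family of 2-sets once singletons are padded. Therefore
-- m 2^∣X∣ ≤ (∣X∣ + 1) 2^r, and as (w + 1) / 2^w decreases in w, m ≤ 2^k (r − k + 1).

module Submission where

open import Defs
open import Level using (0ℓ)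
open import Algebra.Bundles using (AbelianGroup)
open import Algebra.Structures using (IsAbelianGroup)
import Algebra.Properties.AbelianGroup as AbelianGroupProperties
import Algebra.Properties.CommutativeSemigroup as CommutativeSemigroupProperties
open import Data.Nat using (ℕ; zero; suc; _+_; _*_; _^_; _∸_; _<_; _≤_; s≤s; z≤n; _≡ᵇ_; _<?_; _≤?_)
open import Data.Nat.Properties
  using ( +-suc; +-comm; suc-injective; ≤-trans; ≤-refl; ≤-antisym; ≤-reflexive; ≤-pred; n≤1+n; m≤n⇒m≤1+n
        ; +-cancelˡ-≤; +-cancelʳ-≡; +-monoʳ-≤; +-mono-≤; +-identityʳ; *-suc; *-assoc; *-monoˡ-≤; *-monoʳ-≤
        ; *-cancelʳ-≤; m^n≢0; ^-monoʳ-≤; ^-distribˡ-+-*; m≤n+m∸n; m≤m+n; m+n≤o⇒m≤o∸n; m≤n⇒m<n∨m≡n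
        ; n≤0⇒n≡0; <⇒≱; ≮⇒≥; *-commutativeSemigroup; module ≤-Reasoning )
open import Data.Nat.Induction using (<-wellFounded)
open import Data.Nat.Tactic.RingSolver using (solve-∀)
open import Data.Bool using (Bool; true; false)
open import Data.Bool.Properties using (xor-assoc; xor-comm; xor-identityˡ; xor-identityʳ; xor-same)
import Data.Bool.Properties as Bool
open import Data.Fin using (Fin)
import Data.Fin as F
open import Data.Fin.Subset using (Subset; _∈_; _∉_; _⊆_; _⊂_; ∣_∣; ⁅_⁆; ⊥; Nonempty; _∩_; _-_)
open import Data.Fin.Subset.Properties
  using ( drop-there; drop-∷-⊆; in⊆in; out⊆; x∈⁅x⁆; x∈⁅y⁆⇒x≡y; ∣⁅x⁆∣≡1; ⊥⊆; ∉⊥; ∣⊥∣≡0; nonempty?; Empty-unique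
        ; ⊆-antisym; ⊆-⊂-trans; p⊂q⇒∣p∣<∣q∣; x∈p∩q⁺; x∈p∩q⁻; x∈p∧x≢y⇒x∈p-y; x∈p⇒∣p-x∣<∣p∣
        ; _∈?_; _⊆?_; anySubset? )
open import Data.Vec using (Vec; []; _∷_; here; there)
open import Data.Vec.Properties
  using (zipWith-assoc; zipWith-comm; zipWith-identityˡ; zipWith-identityʳ; ≡-dec; ∷-injective; ∷-injectiveʳ)
open import Data.List using (List; []; _∷_; [_]; length; map; filter; _++_; cartesianProduct; allFin)
open import Data.List.Properties using (length-map; length-++; length-tabulate)
open import Data.List.Membership.Propositional using (find) renaming (_∈_ to _∈ˡ_)
open import Data.List.Membership.Propositional.Properties
  using (∈-map⁺; ∈-map⁻; ∈-++⁺ˡ; ∈-++⁺ʳ; ∈-++⁻; ∈-filter⁻; ∈-cartesianProduct⁻)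
open import Data.List.Relation.Binary.Sublist.Propositional.Properties using (filter⁺; filter-⊆; length-mono-≤)
open import Data.List.Relation.Unary.All as All using ([]; all?)
import Data.List.Relation.Unary.All.Properties as AllProperties
open import Data.List.Relation.Unary.AllPairs using ([]; _∷_)
open import Data.List.Relation.Unary.Any using (here; there)
open import Data.List.Relation.Unary.Unique.Propositional using (Unique)
import Data.List.Relation.Unary.Unique.Propositional.Properties as Unique
open import Data.Product using (∃; _×_; _,_; proj₁; proj₂)
import Data.Product as Product
open import Data.Sum using (_⊎_; inj₁; inj₂)
import Data.Sum as Sum
open import Data.Empty using (⊥-elim)
open import Function using (_∘_; id)
open import Induction.WellFounded using (Acc; acc)
open import Relation.Binary.Definitions using (DecidableEquality)
open import Relation.Binary.PropositionalEquality
  using (_≡_; _≢_; refl; sym; trans; cong; cong₂; subst; subst₂; isEquivalence; module ≡-Reasoning)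
open import Relation.Nullary using (¬_; Dec; yes; no)
open import Relation.Nullary.Decidable using (_×-dec_; ¬?; decidable-stable)
open import Relation.Nullary.Negation using (¬¬-map)
open import Relation.Unary using (Pred; Decidable)

-- GF(2)-vectors and symmetric difference

⊕-self : ∀ {n} (x : Vec Bool n) → x ⊕ x ≡ zeroV
⊕-self []      = refl
⊕-self (a ∷ x) = cong₂ _∷_ (xor-same a) (⊕-self x)

⊕-isAbelianGroup : ∀ n → IsAbelianGroup _≡_ (_⊕_ {n}) zeroV id
⊕-isAbelianGroup n = record
  { isGroup = record
    { isMonoid = record
      { isSemigroup = record
        { isMagma = record { isEquivalence = isEquivalence ; ∙-cong = cong₂ _⊕_ }
        ; assoc = zipWith-assoc xor-assoc
        }
      ; identity = zipWith-identityˡ xor-identityˡ , zipWith-identityʳ xor-identityʳ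
      }
    ; inverse = ⊕-self , ⊕-self
    ; ⁻¹-cong = id
    }
  ; comm = zipWith-comm xor-comm
  }

⊕-abelianGroup : ℕ → AbelianGroup 0ℓ 0ℓ
⊕-abelianGroup n = record { isAbelianGroup = ⊕-isAbelianGroup n }

module ⊕-Properties {n : ℕ} where
  open AbelianGroup (⊕-abelianGroup n) public
    using () renaming (assoc to ⊕-assoc; comm to ⊕-comm; identityˡ to ⊕-identityˡ; identityʳ to ⊕-identityʳ)
  open AbelianGroupProperties (⊕-abelianGroup n) public
    using () renaming ( //-rightDividesˡ to [y⊕x]⊕x≡y; \\-leftDividesʳ to x⊕[x⊕y]≡y; x∙y⁻¹≈ε⇒x≈y to x⊕y≡0⇒x≡y
                      ; ∙-cancelˡ to ⊕-cancelˡ; ∙-cancelʳ to ⊕-cancelʳ )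
  open CommutativeSemigroupProperties (AbelianGroup.commutativeSemigroup (⊕-abelianGroup n)) public
    using () renaming (interchange to ⊕-interchange; x∙yz≈y∙xz to x⊕[y⊕z]≡y⊕[x⊕z])
open ⊕-Properties

[x⊕y]⊕[x⊕z]≡y⊕z : ∀ {n} (x y z : Vec Bool n) → (x ⊕ y) ⊕ (x ⊕ z) ≡ y ⊕ z
[x⊕y]⊕[x⊕z]≡y⊕z x y z = begin
  (x ⊕ y) ⊕ (x ⊕ z)  ≡⟨ ⊕-interchange x y x z ⟩
  (x ⊕ x) ⊕ (y ⊕ z)  ≡⟨ cong (_⊕ (y ⊕ z)) (⊕-self x) ⟩
  zeroV ⊕ (y ⊕ z)    ≡⟨ ⊕-identityˡ (y ⊕ z) ⟩
  y ⊕ z              ∎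
  where open ≡-Reasoning

-- On Subset m = Vec Bool m, _⊕_ is symmetric difference.
x∈p⊕q⁻ : ∀ {n} {p q : Subset n} {x} → x ∈ p ⊕ q → (x ∈ p × x ∉ q) ⊎ (x ∉ p × x ∈ q)
x∈p⊕q⁻ {p = true ∷ _}  {false ∷ _} here = inj₁ (here , λ ())
x∈p⊕q⁻ {p = false ∷ _} {true ∷ _}  here = inj₂ ((λ ()) , here)
x∈p⊕q⁻ {p = _ ∷ _}     {_ ∷ _}     (there x∈) =
  Sum.map (Product.map there (_∘ drop-there)) (Product.map (_∘ drop-there) there) (x∈p⊕q⁻ x∈)

x∈p⊕q⁺ˡ : ∀ {n} {p q : Subset n} {x} → x ∈ p → x ∉ q → x ∈ p ⊕ q
x∈p⊕q⁺ˡ {q = false ∷ _} here       x∉q = here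
x∈p⊕q⁺ˡ {q = true ∷ _}  here       x∉q = ⊥-elim (x∉q here)
x∈p⊕q⁺ˡ {q = _ ∷ _}     (there x∈p) x∉q = there (x∈p⊕q⁺ˡ x∈p (x∉q ∘ there))

x∈p⊕q⁺ʳ : ∀ {n} {p q : Subset n} {x} → x ∉ p → x ∈ q → x ∈ p ⊕ q
x∈p⊕q⁺ʳ {p = p} {q} x∉p x∈q = subst (_ ∈_) (⊕-comm q p) (x∈p⊕q⁺ˡ x∈q x∉p)

x∉p⊕q : ∀ {n} {p q : Subset n} {x} → x ∉ p → x ∉ q → x ∉ p ⊕ q
x∉p⊕q x∉p x∉q x∈ = Sum.[ x∉p ∘ proj₁ , x∉q ∘ proj₂ ] (x∈p⊕q⁻ x∈)

x∉p⊕q′ : ∀ {n} {p q : Subset n} {x} → x ∈ p → x ∈ q → x ∉ p ⊕ q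
x∉p⊕q′ x∈p x∈q x∈ = Sum.[ (λ (_ , x∉q) → x∉q x∈q) , (λ (x∉p , _) → x∉p x∈p) ] (x∈p⊕q⁻ x∈)

x∈p⇒⁅x⁆⊆p : ∀ {n} {p : Subset n} {x} → x ∈ p → ⁅ x ⁆ ⊆ p
x∈p⇒⁅x⁆⊆p {p = p} {x} x∈p y∈⁅x⁆ = subst (_∈ p) (sym (x∈⁅y⁆⇒x≡y x y∈⁅x⁆)) x∈p

p⊕r⊆q⊕r : ∀ {n} {p q r : Subset n} → r ⊆ p → p ⊆ q → p ⊕ r ⊆ q ⊕ r
p⊕r⊆q⊕r r⊆p p⊆q x∈ with x∈p⊕q⁻ x∈
... | inj₁ (x∈p , x∉r) = x∈p⊕q⁺ˡ (p⊆q x∈p) x∉r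
... | inj₂ (x∉p , x∈r) = ⊥-elim (x∉p (r⊆p x∈r))

p⊕q⊆r : ∀ {n} {p q r : Subset n} → p ⊆ r → q ⊆ r → p ⊕ q ⊆ r
p⊕q⊆r p⊆r q⊆r x∈ = Sum.[ p⊆r ∘ proj₁ , q⊆r ∘ proj₂ ] (x∈p⊕q⁻ x∈)

∣p⊕q∣≡∣p∣+∣q∣ : ∀ {n} (p q : Subset n) → (∀ {x} → x ∈ p → x ∉ q) → ∣ p ⊕ q ∣ ≡ ∣ p ∣ + ∣ q ∣
∣p⊕q∣≡∣p∣+∣q∣ []          []          _ = refl
∣p⊕q∣≡∣p∣+∣q∣ (true ∷ p)  (true ∷ q)  disj = ⊥-elim (disj here here)
∣p⊕q∣≡∣p∣+∣q∣ (true ∷ p)  (false ∷ q) disj = cong suc (∣p⊕q∣≡∣p∣+∣q∣ p q λ x∈p x∈q → disj (there x∈p) (there x∈q))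
∣p⊕q∣≡∣p∣+∣q∣ (false ∷ p) (true ∷ q)  disj =
  trans (cong suc (∣p⊕q∣≡∣p∣+∣q∣ p q λ x∈p x∈q → disj (there x∈p) (there x∈q))) (sym (+-suc ∣ p ∣ ∣ q ∣))
∣p⊕q∣≡∣p∣+∣q∣ (false ∷ p) (false ∷ q) disj = ∣p⊕q∣≡∣p∣+∣q∣ p q λ x∈p x∈q → disj (there x∈p) (there x∈q)

∣p⊕q∣+∣q∣≡∣p∣ : ∀ {n} (p q : Subset n) → q ⊆ p → ∣ p ⊕ q ∣ + ∣ q ∣ ≡ ∣ p ∣
∣p⊕q∣+∣q∣≡∣p∣ []          []          _   = refl
∣p⊕q∣+∣q∣≡∣p∣ (true ∷ p)  (true ∷ q)  q⊆p = trans (+-suc ∣ p ⊕ q ∣ ∣ q ∣) (cong suc (∣p⊕q∣+∣q∣≡∣p∣ p q (drop-∷-⊆ q⊆p)))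
∣p⊕q∣+∣q∣≡∣p∣ (true ∷ p)  (false ∷ q) q⊆p = cong suc (∣p⊕q∣+∣q∣≡∣p∣ p q (drop-∷-⊆ q⊆p))
∣p⊕q∣+∣q∣≡∣p∣ (false ∷ p) (true ∷ q)  q⊆p with () ← q⊆p here
∣p⊕q∣+∣q∣≡∣p∣ (false ∷ p) (false ∷ q) q⊆p = ∣p⊕q∣+∣q∣≡∣p∣ p q (drop-∷-⊆ q⊆p)

∣p⊕⁅x⁆∣≡1+∣p∣ : ∀ {n} {p : Subset n} {x} → x ∉ p → ∣ p ⊕ ⁅ x ⁆ ∣ ≡ suc ∣ p ∣
∣p⊕⁅x⁆∣≡1+∣p∣ {p = p} {x} x∉p = begin
  ∣ p ⊕ ⁅ x ⁆ ∣      ≡⟨ ∣p⊕q∣≡∣p∣+∣q∣ p ⁅ x ⁆ (λ y∈p y∈⁅x⁆ → x∉p (subst (_∈ p) (x∈⁅y⁆⇒x≡y x y∈⁅x⁆) y∈p)) ⟩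
  ∣ p ∣ + ∣ ⁅ x ⁆ ∣  ≡⟨ cong (∣ p ∣ +_) (∣⁅x⁆∣≡1 x) ⟩
  ∣ p ∣ + 1          ≡⟨ +-comm ∣ p ∣ 1 ⟩
  suc ∣ p ∣          ∎
  where open ≡-Reasoning

1+∣p⊕⁅x⁆∣≡∣p∣ : ∀ {n} {p : Subset n} {x} → x ∈ p → suc ∣ p ⊕ ⁅ x ⁆ ∣ ≡ ∣ p ∣
1+∣p⊕⁅x⁆∣≡∣p∣ {p = p} {x} x∈p = begin
  suc ∣ p ⊕ ⁅ x ⁆ ∣          ≡⟨ +-comm 1 _ ⟩
  ∣ p ⊕ ⁅ x ⁆ ∣ + 1          ≡⟨ cong (∣ p ⊕ ⁅ x ⁆ ∣ +_) (∣⁅x⁆∣≡1 x) ⟨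
  ∣ p ⊕ ⁅ x ⁆ ∣ + ∣ ⁅ x ⁆ ∣  ≡⟨ ∣p⊕q∣+∣q∣≡∣p∣ p ⁅ x ⁆ (λ y∈⁅x⁆ → subst (_∈ p) (sym (x∈⁅y⁆⇒x≡y x y∈⁅x⁆)) x∈p) ⟩
  ∣ p ∣                      ∎
  where open ≡-Reasoning

∣p∣≡0⇒p≡⊥ : ∀ {n} (p : Subset n) → ∣ p ∣ ≡ 0 → p ≡ ⊥
∣p∣≡0⇒p≡⊥ []          _  = refl
∣p∣≡0⇒p≡⊥ (false ∷ p) ∣p∣≡0 = cong (false ∷_) (∣p∣≡0⇒p≡⊥ p ∣p∣≡0)

x∈p⇒0<∣p∣ : ∀ {n} {p : Subset n} {x} → x ∈ p → 0 < ∣ p ∣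
x∈p⇒0<∣p∣ x∈p = ≤-trans (s≤s z≤n) (x∈p⇒∣p-x∣<∣p∣ x∈p)

0<∣p∣⇒nonempty : ∀ {n} (p : Subset n) → 0 < ∣ p ∣ → Nonempty p
0<∣p∣⇒nonempty {n} p 0<∣p∣ with nonempty? p
... | yes ne = ne
... | no ¬ne with () ← subst (0 <_) (trans (cong ∣_∣ (Empty-unique ¬ne)) (∣⊥∣≡0 n)) 0<∣p∣

∣p∣≡1⇒p≡⁅x⁆ : ∀ {n} {p : Subset n} {x} → ∣ p ∣ ≡ 1 → x ∈ p → p ≡ ⁅ x ⁆
∣p∣≡1⇒p≡⁅x⁆ {p = p} {x} ∣p∣≡1 x∈p = begin
  p                      ≡⟨ [y⊕x]⊕x≡y ⁅ x ⁆ p ⟨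
  (p ⊕ ⁅ x ⁆) ⊕ ⁅ x ⁆    ≡⟨ cong (_⊕ ⁅ x ⁆) (∣p∣≡0⇒p≡⊥ _ (suc-injective (trans (1+∣p⊕⁅x⁆∣≡∣p∣ x∈p) ∣p∣≡1))) ⟩
  ⊥ ⊕ ⁅ x ⁆              ≡⟨ ⊕-identityˡ ⁅ x ⁆ ⟩
  ⁅ x ⁆                  ∎
  where open ≡-Reasoning

x∈p⊕q∧x∉q⇒x∈p : ∀ {n} {p q : Subset n} {x} → x ∈ p ⊕ q → x ∉ q → x ∈ p
x∈p⊕q∧x∉q⇒x∈p x∈ x∉q = Sum.[ proj₁ , (λ (_ , x∈q) → ⊥-elim (x∉q x∈q)) ] (x∈p⊕q⁻ x∈)

x∈⁅y⁆⊕⁅z⁆⁻ : ∀ {n} {x y z : Fin n} → x ∈ ⁅ y ⁆ ⊕ ⁅ z ⁆ → x ≡ y ⊎ x ≡ z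
x∈⁅y⁆⊕⁅z⁆⁻ {y = y} {z} x∈ = Sum.map (x∈⁅y⁆⇒x≡y y ∘ proj₁) (x∈⁅y⁆⇒x≡y z ∘ proj₂) (x∈p⊕q⁻ x∈)

p⊆⁅x⁆⇒p≡⁅x⁆ : ∀ {n} {p : Subset n} {x} → p ⊆ ⁅ x ⁆ → Nonempty p → p ≡ ⁅ x ⁆
p⊆⁅x⁆⇒p≡⁅x⁆ {p = p} {x} p⊆⁅x⁆ (y , y∈p) = ⊆-antisym p⊆⁅x⁆ λ z∈⁅x⁆ →
  subst (_∈ p) (trans (x∈⁅y⁆⇒x≡y x (p⊆⁅x⁆ y∈p)) (sym (x∈⁅y⁆⇒x≡y x z∈⁅x⁆))) y∈p

p⊂⁅x⁆⇒p⊆⊥ : ∀ {n} {p : Subset n} {x} → p ⊂ ⁅ x ⁆ → p ⊆ ⊥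
p⊂⁅x⁆⇒p⊆⊥ {p = p} {x} (p⊆⁅x⁆ , y , y∈⁅x⁆ , y∉p) z∈p =
  ⊥-elim (y∉p (subst (_∈ p) (trans (x∈⁅y⁆⇒x≡y x (p⊆⁅x⁆ z∈p)) (sym (x∈⁅y⁆⇒x≡y x y∈⁅x⁆))) z∈p))

p⊂⁅x⁆⊕⁅y⁆ : ∀ {n} {p : Subset n} {x y} → p ⊂ ⁅ x ⁆ ⊕ ⁅ y ⁆ → p ⊆ ⁅ x ⁆ ⊎ p ⊆ ⁅ y ⁆
p⊂⁅x⁆⊕⁅y⁆ {p = p} (p⊆ , z , z∈ , z∉p) with x∈⁅y⁆⊕⁅z⁆⁻ z∈
... | inj₁ refl = inj₂ λ w∈p → Sum.[ (λ { refl → ⊥-elim (z∉p w∈p) }) , (λ { refl → x∈⁅x⁆ _ }) ] (x∈⁅y⁆⊕⁅z⁆⁻ (p⊆ w∈p))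
... | inj₂ refl = inj₁ λ w∈p → Sum.[ (λ { refl → x∈⁅x⁆ _ }) , (λ { refl → ⊥-elim (z∉p w∈p) }) ] (x∈⁅y⁆⊕⁅z⁆⁻ (p⊆ w∈p))

∣p⊕q∣≤∣p∣+∣q∣ : ∀ {n} (p q : Subset n) → ∣ p ⊕ q ∣ ≤ ∣ p ∣ + ∣ q ∣
∣p⊕q∣≤∣p∣+∣q∣ []          []          = z≤n
∣p⊕q∣≤∣p∣+∣q∣ (true ∷ p)  (true ∷ q)  = m≤n⇒m≤1+n (≤-trans (∣p⊕q∣≤∣p∣+∣q∣ p q) (+-monoʳ-≤ ∣ p ∣ (n≤1+n ∣ q ∣)))
∣p⊕q∣≤∣p∣+∣q∣ (true ∷ p)  (false ∷ q) = s≤s (∣p⊕q∣≤∣p∣+∣q∣ p q)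
∣p⊕q∣≤∣p∣+∣q∣ (false ∷ p) (true ∷ q)  = ≤-trans (s≤s (∣p⊕q∣≤∣p∣+∣q∣ p q)) (≤-reflexive (sym (+-suc ∣ p ∣ ∣ q ∣)))
∣p⊕q∣≤∣p∣+∣q∣ (false ∷ p) (false ∷ q) = ∣p⊕q∣≤∣p∣+∣q∣ p q

∣p∣≡1⇒singleton : ∀ {n} {p : Subset n} → ∣ p ∣ ≡ 1 → ∃ λ x → p ≡ ⁅ x ⁆
∣p∣≡1⇒singleton {p = p} ∣p∣≡1 with 0<∣p∣⇒nonempty p (≤-reflexive (sym ∣p∣≡1))
... | x , x∈p = x , ∣p∣≡1⇒p≡⁅x⁆ ∣p∣≡1 x∈p

∣p∣≡2⇒pair : ∀ {n} {p : Subset n} {x} → ∣ p ∣ ≡ 2 → x ∈ p → ∃ λ y → y ≢ x × p ≡ ⁅ x ⁆ ⊕ ⁅ y ⁆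
∣p∣≡2⇒pair {p = p} {x} ∣p∣≡2 x∈p with ∣p∣≡1⇒singleton (suc-injective (trans (1+∣p⊕⁅x⁆∣≡∣p∣ x∈p) ∣p∣≡2))
... | y , p-x≡⁅y⁆ = y , y≢x , (begin
  p                      ≡⟨ [y⊕x]⊕x≡y ⁅ x ⁆ p ⟨
  (p ⊕ ⁅ x ⁆) ⊕ ⁅ x ⁆    ≡⟨ cong (_⊕ ⁅ x ⁆) p-x≡⁅y⁆ ⟩
  ⁅ y ⁆ ⊕ ⁅ x ⁆          ≡⟨ ⊕-comm ⁅ y ⁆ ⁅ x ⁆ ⟩
  ⁅ x ⁆ ⊕ ⁅ y ⁆          ∎)
  where
  open ≡-Reasoning
  y≢x : y ≢ x
  y≢x refl = x∉p⊕q′ x∈p (x∈⁅x⁆ x) (subst (x ∈_) (sym p-x≡⁅y⁆) (x∈⁅x⁆ x))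

pair-≡ : ∀ {n} {p : Subset n} {x y} → ∣ p ∣ ≡ 2 → x ∈ p → y ∈ p → y ≢ x → p ≡ ⁅ x ⁆ ⊕ ⁅ y ⁆
pair-≡ {p = p} ∣p∣≡2 x∈p y∈p y≢x with ∣p∣≡2⇒pair ∣p∣≡2 x∈p
... | z , _ , p≡⁅x⁆⊕⁅z⁆ with x∈⁅y⁆⊕⁅z⁆⁻ (subst (_ ∈_) p≡⁅x⁆⊕⁅z⁆ y∈p)
...   | inj₁ y≡x = ⊥-elim (y≢x y≡x)
...   | inj₂ refl = p≡⁅x⁆⊕⁅z⁆

other-∈ : ∀ {n} {p q : Subset n} {x y} → p ≡ ⁅ x ⁆ ⊕ ⁅ y ⁆ → x ∉ q → Nonempty (p ∩ q) → y ∈ q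
other-∈ refl x∉q (z , z∈) with x∈p∩q⁻ _ _ z∈
... | z∈p , z∈q = Sum.[ (λ { refl → ⊥-elim (x∉q z∈q) }) , (λ { refl → z∈q }) ] (x∈⁅y⁆⊕⁅z⁆⁻ z∈p)

-- Column sums and spans

colSum-⊥ : ∀ {n m} (A : BinRep n m) → colSum A ⊥ ≡ zeroV
colSum-⊥ {m = zero}  A = refl
colSum-⊥ {m = suc m} A = colSum-⊥ (A ∘ F.suc)

colSum-⁅⁆ : ∀ {n m} (A : BinRep n m) i → colSum A ⁅ i ⁆ ≡ A i
colSum-⁅⁆ A F.zero    = trans (cong (A F.zero ⊕_) (colSum-⊥ (A ∘ F.suc))) (⊕-identityʳ (A F.zero))
colSum-⁅⁆ A (F.suc i) = colSum-⁅⁆ (A ∘ F.suc) i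

colSum-⊕ : ∀ {n m} (A : BinRep n m) (p q : Subset m) → colSum A (p ⊕ q) ≡ colSum A p ⊕ colSum A q
colSum-⊕ A []          []          = sym (⊕-identityˡ zeroV)
colSum-⊕ A (true ∷ p)  (true ∷ q)  =
  trans (colSum-⊕ (A ∘ F.suc) p q) (sym ([x⊕y]⊕[x⊕z]≡y⊕z (A F.zero) _ _))
colSum-⊕ A (true ∷ p)  (false ∷ q) =
  trans (cong (A F.zero ⊕_) (colSum-⊕ (A ∘ F.suc) p q)) (sym (⊕-assoc (A F.zero) _ _))
colSum-⊕ A (false ∷ p) (true ∷ q)  =
  trans (cong (A F.zero ⊕_) (colSum-⊕ (A ∘ F.suc) p q)) (x⊕[y⊕z]≡y⊕[x⊕z] (A F.zero) _ _)
colSum-⊕ A (false ∷ p) (false ∷ q) = colSum-⊕ (A ∘ F.suc) p q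

colSum-closed : ∀ {n m} (P : Vec Bool n → Set) → P zeroV → (∀ {u v} → P u → P v → P (u ⊕ v)) →
                (A : BinRep n m) → (∀ i → P (A i)) → ∀ p → P (colSum A p)
colSum-closed P P0 P⊕ A PA []          = P0
colSum-closed P P0 P⊕ A PA (true ∷ p)  = P⊕ (PA F.zero) (colSum-closed P P0 P⊕ (A ∘ F.suc) (PA ∘ F.suc) p)
colSum-closed P P0 P⊕ A PA (false ∷ p) = colSum-closed P P0 P⊕ (A ∘ F.suc) (PA ∘ F.suc) p

Spans : ∀ {n m} → BinRep n m → Subset m → Vec Bool n → Set
Spans A X v = ∃ λ Z → Z ⊆ X × colSum A Z ≡ v

module _ {n m} {A : BinRep n m} {X : Subset m} where

  spans? : ∀ v → Dec (Spans A X v)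
  spans? v = anySubset? λ Z → Z ⊆? X ×-dec ≡-dec Bool._≟_ (colSum A Z) v

  spans-column : ∀ {x} → x ∈ X → Spans A X (A x)
  spans-column {x} x∈X = ⁅ x ⁆ , x∈p⇒⁅x⁆⊆p x∈X , colSum-⁅⁆ A x

  spans-zero : Spans A X zeroV
  spans-zero = ⊥ , ⊥⊆ , colSum-⊥ A

  spans-⊕ : ∀ {u v} → Spans A X u → Spans A X v → Spans A X (u ⊕ v)
  spans-⊕ (Y , Y⊆X , ΣY≡u) (Z , Z⊆X , ΣZ≡v) = Y ⊕ Z , p⊕q⊆r Y⊆X Z⊆X , trans (colSum-⊕ A Y Z) (cong₂ _⊕_ ΣY≡u ΣZ≡v)

  spans-colSum : (∀ i → Spans A X (A i)) → ∀ Z → Spans A X (colSum A Z)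
  spans-colSum = colSum-closed (Spans A X) spans-zero spans-⊕ A

-- Independence, simplicity and bases

module _ {n m} {A : BinRep n m} where

  independent-⊆ : ∀ {X Y} → Y ⊆ X → Independent A X → Independent A Y
  independent-⊆ Y⊆X indepX (W , W⊆Y , dep) = indepX (W , (λ x∈W → Y⊆X (W⊆Y x∈W)) , dep)

  ⊥-independent : Independent A ⊥
  ⊥-independent (W , W⊆⊥ , (x , x∈W) , _) = ∉⊥ (W⊆⊥ x∈W)

  ⁅⁆-independent : ∀ {e} → A e ≢ zeroV → Independent A ⁅ e ⁆
  ⁅⁆-independent {e} Ae≢0 (W , W⊆⁅e⁆ , W≢∅ , ΣW≡0) =
    Ae≢0 (trans (sym (colSum-⁅⁆ A e)) (trans (cong (colSum A) (sym (p⊆⁅x⁆⇒p≡⁅x⁆ W⊆⁅e⁆ W≢∅))) ΣW≡0))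

  simple⇒nonzero : Simple A → ∀ e → A e ≢ zeroV
  simple⇒nonzero (noLoop , _) e Ae≡0 = noLoop e (⁅ e ⁆ , (dependent , minimal) , x∈⁅x⁆ e , ∣⁅x⁆∣≡1 e)
    where
    dependent : Dependent A ⁅ e ⁆
    dependent = ⁅ e ⁆ , id , (e , x∈⁅x⁆ e) , trans (colSum-⁅⁆ A e) Ae≡0
    minimal : ∀ Y → Y ⊂ ⁅ e ⁆ → Independent A Y
    minimal Y Y⊂⁅e⁆ = independent-⊆ (p⊂⁅x⁆⇒p⊆⊥ Y⊂⁅e⁆) ⊥-independent

  simple⇒injective : Simple A → ∀ {e f} → A e ≡ A f → e ≡ f
  simple⇒injective simple@(_ , noParallel) {e} {f} Ae≡Af with e F.≟ f
  ... | yes e≡f = e≡f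
  ... | no e≢f  = ⊥-elim (noParallel e f (e≢f , C , (dependent , minimal) , e∈C , f∈C , ∣C∣≡2))
    where
    C = ⁅ e ⁆ ⊕ ⁅ f ⁆
    e∈C = x∈p⊕q⁺ˡ (x∈⁅x⁆ e) (e≢f ∘ x∈⁅y⁆⇒x≡y f)
    f∈C = x∈p⊕q⁺ʳ (e≢f ∘ sym ∘ x∈⁅y⁆⇒x≡y e) (x∈⁅x⁆ f)
    ∣C∣≡2 : ∣ C ∣ ≡ 2
    ∣C∣≡2 = trans (∣p⊕⁅x⁆∣≡1+∣p∣ (e≢f ∘ sym ∘ x∈⁅y⁆⇒x≡y e)) (cong suc (∣⁅x⁆∣≡1 e))
    dependent : Dependent A C
    dependent = C , id , (e , e∈C) ,
      trans (colSum-⊕ A ⁅ e ⁆ ⁅ f ⁆) (trans (cong₂ _⊕_ (colSum-⁅⁆ A e) (colSum-⁅⁆ A f))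
        (trans (cong (A e ⊕_) (sym Ae≡Af)) (⊕-self (A e))))
    minimal : ∀ Y → Y ⊂ C → Independent A Y
    minimal Y Y⊂C with p⊂⁅x⁆⊕⁅y⁆ Y⊂C
    ... | inj₁ Y⊆⁅e⁆ = independent-⊆ Y⊆⁅e⁆ (⁅⁆-independent (simple⇒nonzero simple e))
    ... | inj₂ Y⊆⁅f⁆ = independent-⊆ Y⊆⁅f⁆ (⁅⁆-independent (simple⇒nonzero simple f))

  basis-spans : ∀ {B} → Basis A B → ∀ e → Spans A B (A e)
  basis-spans {B} (indepB , maximal) e with e ∈? B
  ... | yes e∈B = spans-column e∈B
  ... | no e∉B with maximal (B ⊕ ⁅ e ⁆) ((λ x∈B → x∈p⊕q⁺ˡ x∈B λ x∈⁅e⁆ → e∉B (subst (_∈ B) (x∈⁅y⁆⇒x≡y e x∈⁅e⁆) x∈B))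
                                       , e , x∈p⊕q⁺ʳ e∉B (x∈⁅x⁆ e) , e∉B)
  ...   | W , W⊆B+e , W≢∅ , ΣW≡0 with e ∈? W
  ...     | no e∉W = ⊥-elim (indepB (W , W⊆B , W≢∅ , ΣW≡0))
    where
    W⊆B : W ⊆ B
    W⊆B x∈W = x∈p⊕q∧x∉q⇒x∈p (W⊆B+e x∈W) λ x∈⁅e⁆ → e∉W (subst (_∈ W) (x∈⁅y⁆⇒x≡y e x∈⁅e⁆) x∈W)
  ...     | yes e∈W = W ⊕ ⁅ e ⁆ , W-e⊆B , (begin
    colSum A (W ⊕ ⁅ e ⁆)            ≡⟨ colSum-⊕ A W ⁅ e ⁆ ⟩
    colSum A W ⊕ colSum A ⁅ e ⁆     ≡⟨ cong₂ _⊕_ ΣW≡0 (colSum-⁅⁆ A e) ⟩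
    zeroV ⊕ A e                     ≡⟨ ⊕-identityˡ (A e) ⟩
    A e                             ∎)
    where
    open ≡-Reasoning
    W-e⊆B : W ⊕ ⁅ e ⁆ ⊆ B
    W-e⊆B x∈ with x∈p⊕q⁻ x∈
    ... | inj₁ (x∈W , x∉⁅e⁆) = x∈p⊕q∧x∉q⇒x∈p (W⊆B+e x∈W) x∉⁅e⁆
    ... | inj₂ (x∉W , x∈⁅e⁆) = ⊥-elim (x∉W (subst (_∈ W) (sym (x∈⁅y⁆⇒x≡y e x∈⁅e⁆)) e∈W))

  ¬coloop⇒¬¬avoiding-basis : ∀ {t} → ¬ Coloop A t → ¬ ¬ (∃ λ B → Basis A B × t ∉ B)
  ¬coloop⇒¬¬avoiding-basis {t} ¬coloop ¬avoiding =
    ¬coloop λ B basis → decidable-stable (t ∈? B) λ t∉B → ¬avoiding (B , basis , t∉B)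

MinimumCardinality : ∀ {m} → Pred (Subset m) 0ℓ → Subset m → Set
MinimumCardinality P X = P X × (∀ Y → P Y → ∣ X ∣ ≤ ∣ Y ∣)

minimum-cardinality : ∀ {m} {P : Pred (Subset m) 0ℓ} → Decidable P → ∀ {Y} → P Y → ∃ (MinimumCardinality P)
minimum-cardinality {P = P} P? {Y} = go Y (<-wellFounded ∣ Y ∣)
  where
  go : ∀ Y → Acc _<_ ∣ Y ∣ → P Y → ∃ (MinimumCardinality P)
  go Y (acc smaller) PY with anySubset? (λ Z → P? Z ×-dec ∣ Z ∣ <? ∣ Y ∣)
  ... | yes (Z , PZ , ∣Z∣<∣Y∣) = go Z (smaller ∣Z∣<∣Y∣) PZ
  ... | no  ¬smaller           = Y , PY , λ Z PZ → ≮⇒≥ λ ∣Z∣<∣Y∣ → ¬smaller (Z , PZ , ∣Z∣<∣Y∣)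

-- Distinct singletons and intersecting families of 2-sets

map⁺-on : ∀ {A B : Set} {f : A → B} {xs : List A} →
          (∀ {x y} → x ∈ˡ xs → y ∈ˡ xs → f x ≡ f y → x ≡ y) → Unique xs → Unique (map f xs)
map⁺-on {xs = []}     _   []            = []
map⁺-on {xs = x ∷ xs} inj (x∉xs ∷ uniq) =
  AllProperties.map⁺ (All.tabulate λ y∈xs fx≡fy → All.lookup x∉xs y∈xs (inj (here refl) (there y∈xs) fx≡fy))
  ∷ map⁺-on (λ x∈ y∈ → inj (there x∈) (there y∈)) uniq

singletons-bound : ∀ {m} {Y : Subset m} {L : List (Subset m)} → Unique L →
                   (∀ {S} → S ∈ˡ L → S ⊆ Y × ∣ S ∣ ≡ 1) → length L ≤ ∣ Y ∣
singletons-bound {L = []} _ _ = z≤n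
singletons-bound {Y = Y} {L = S ∷ L} (S∉L ∷ unique) singletons with singletons (here refl)
... | S⊆Y , ∣S∣≡1 with ∣p∣≡1⇒singleton {p = S} ∣S∣≡1
...   | x , refl = begin-strict
  length L   ≤⟨ singletons-bound unique in-Y-x ⟩
  ∣ Y - x ∣  <⟨ x∈p⇒∣p-x∣<∣p∣ (S⊆Y (x∈⁅x⁆ x)) ⟩
  ∣ Y ∣      ∎
  where
  open ≤-Reasoning
  in-Y-x : ∀ {T} → T ∈ˡ L → T ⊆ Y - x × ∣ T ∣ ≡ 1
  in-Y-x T∈L with singletons (there T∈L)
  ... | T⊆Y , ∣T∣≡1 = (λ y∈T → x∈p∧x≢y⇒x∈p-y (T⊆Y y∈T) λ { refl → All.lookup S∉L T∈L (sym (∣p∣≡1⇒p≡⁅x⁆ ∣T∣≡1 y∈T)) })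
                    , ∣T∣≡1

translate-bound : ∀ {m} {Y U : Subset m} {L : List (Subset m)} → Unique L →
                  (∀ {S} → S ∈ˡ L → S ⊕ U ⊆ Y × ∣ S ⊕ U ∣ ≡ 1) → length L ≤ ∣ Y ∣
translate-bound {Y = Y} {U} {L} unique singletons =
  subst (_≤ ∣ Y ∣) (length-map (_⊕ U) L) (singletons-bound (Unique.map⁺ (⊕-cancelʳ U _ _) unique) translated)
  where
  translated : ∀ {S} → S ∈ˡ map (_⊕ U) L → S ⊆ Y × ∣ S ∣ ≡ 1
  translated S∈ with ∈-map⁻ (_⊕ U) S∈
  ... | T , T∈L , refl = singletons T∈L

Intersecting : ∀ {m} → List (Subset m) → Set
Intersecting L = ∀ {S T} → S ∈ˡ L → T ∈ˡ L → Nonempty (S ∩ T)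

module IntersectingPairs {m} {Y : Subset m} {L : List (Subset m)} (unique : Unique L)
                         (pairs : ∀ {S} → S ∈ˡ L → S ⊆ Y × ∣ S ∣ ≡ 2) (intersecting : Intersecting L) where

  star : ∀ {a} → a ∈ Y → (∀ {S} → S ∈ˡ L → a ∈ S) → length L < ∣ Y ∣
  star {a} a∈Y all∋a = begin-strict
    length L         ≤⟨ translate-bound unique shifted ⟩
    ∣ Y ⊕ ⁅ a ⁆ ∣    <⟨ ≤-reflexive (1+∣p⊕⁅x⁆∣≡∣p∣ a∈Y) ⟩
    ∣ Y ∣            ∎
    where
    open ≤-Reasoning
    shifted : ∀ {S} → S ∈ˡ L → S ⊕ ⁅ a ⁆ ⊆ Y ⊕ ⁅ a ⁆ × ∣ S ⊕ ⁅ a ⁆ ∣ ≡ 1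
    shifted S∈L = p⊕r⊆q⊕r (x∈p⇒⁅x⁆⊆p (all∋a S∈L)) (proj₁ (pairs S∈L))
                , suc-injective (trans (1+∣p⊕⁅x⁆∣≡∣p∣ (all∋a S∈L)) (proj₂ (pairs S∈L)))

  triangle : ∀ {a b c} → 4 ≤ ∣ Y ∣ → b ≢ a → c ≢ a → c ≢ b →
             ⁅ a ⁆ ⊕ ⁅ b ⁆ ∈ˡ L → ⁅ b ⁆ ⊕ ⁅ c ⁆ ∈ˡ L → ⁅ a ⁆ ⊕ ⁅ c ⁆ ∈ˡ L → length L < ∣ Y ∣
  triangle {a} {b} {c} 4≤∣Y∣ b≢a c≢a c≢b ab∈L bc∈L ac∈L =
    ≤-trans (s≤s (subst (length L ≤_) ∣T∣≡3 (translate-bound unique inside))) 4≤∣Y∣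
    where
    T = (⁅ a ⁆ ⊕ ⁅ b ⁆) ⊕ ⁅ c ⁆
    c∉ab : c ∉ ⁅ a ⁆ ⊕ ⁅ b ⁆
    c∉ab c∈ = Sum.[ c≢a , c≢b ] (x∈⁅y⁆⊕⁅z⁆⁻ c∈)
    ∣T∣≡3 : ∣ T ∣ ≡ 3
    ∣T∣≡3 = trans (∣p⊕⁅x⁆∣≡1+∣p∣ c∉ab) (cong suc (proj₂ (pairs ab∈L)))
    a∈T : a ∈ T
    a∈T = x∈p⊕q⁺ˡ (x∈p⊕q⁺ˡ (x∈⁅x⁆ a) (b≢a ∘ sym ∘ x∈⁅y⁆⇒x≡y b)) (c≢a ∘ sym ∘ x∈⁅y⁆⇒x≡y c)
    b∈T : b ∈ T
    b∈T = x∈p⊕q⁺ˡ (x∈p⊕q⁺ʳ (b≢a ∘ x∈⁅y⁆⇒x≡y a) (x∈⁅x⁆ b)) (c≢b ∘ sym ∘ x∈⁅y⁆⇒x≡y c)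
    c∈T : c ∈ T
    c∈T = x∈p⊕q⁺ʳ c∉ab (x∈⁅x⁆ c)
    edge⊆T : ∀ {x y} → x ∈ T → y ∈ T → ⁅ x ⁆ ⊕ ⁅ y ⁆ ⊆ T
    edge⊆T x∈T y∈T z∈ = Sum.[ (λ { refl → x∈T }) , (λ { refl → y∈T }) ] (x∈⁅y⁆⊕⁅z⁆⁻ z∈)
    other∈ : ∀ {S x w Z} → S ∈ˡ L → S ≡ ⁅ x ⁆ ⊕ ⁅ w ⁆ → x ∉ T → Z ∈ˡ L → Z ⊆ T → w ∈ Z
    other∈ S∈L S≡xw x∉T Z∈L Z⊆T = other-∈ S≡xw (x∉T ∘ Z⊆T) (intersecting S∈L Z∈L)
    -- A member {x, w} with x outside T would need w in all three edges.
    within : ∀ {S} → S ∈ˡ L → S ⊆ T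
    within S∈L {x} x∈S with x ∈? T
    ... | yes x∈T = x∈T
    ... | no  x∉T with ∣p∣≡2⇒pair (proj₂ (pairs S∈L)) x∈S
    ...   | w , _ , S≡xw with x∈⁅y⁆⊕⁅z⁆⁻ (other∈ S∈L S≡xw x∉T ab∈L (edge⊆T a∈T b∈T))
    ...     | inj₁ refl = ⊥-elim (Sum.[ b≢a ∘ sym , c≢a ∘ sym ] (x∈⁅y⁆⊕⁅z⁆⁻ (other∈ S∈L S≡xw x∉T bc∈L (edge⊆T b∈T c∈T))))
    ...     | inj₂ refl = ⊥-elim (Sum.[ b≢a , c≢b ∘ sym ] (x∈⁅y⁆⊕⁅z⁆⁻ (other∈ S∈L S≡xw x∉T ac∈L (edge⊆T a∈T c∈T))))
    inside : ∀ {S} → S ∈ˡ L → S ⊕ T ⊆ T × ∣ S ⊕ T ∣ ≡ 1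
    inside {S} S∈L = p⊕q⊆r (within S∈L) id
                   , +-cancelʳ-≡ 2 _ 1 (begin
                       ∣ S ⊕ T ∣ + 2      ≡⟨ cong₂ _+_ (cong ∣_∣ (⊕-comm S T)) (sym (proj₂ (pairs S∈L))) ⟩
                       ∣ T ⊕ S ∣ + ∣ S ∣  ≡⟨ ∣p⊕q∣+∣q∣≡∣p∣ T S (within S∈L) ⟩
                       ∣ T ∣              ≡⟨ ∣T∣≡3 ⟩
                       3                  ∎)
      where open ≡-Reasoning

  star-or-avoided : ∀ {a} → a ∈ Y → length L < ∣ Y ∣ ⊎ ∃ λ Z → Z ∈ˡ L × a ∉ Z
  star-or-avoided {a} a∈Y with all? (a ∈?_) L
  ... | yes all∋a = inj₁ (star a∈Y (All.lookup all∋a))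
  ... | no ¬all∋a = inj₂ (find (AllProperties.¬All⇒Any¬ (a ∈?_) L ¬all∋a))

  -- With Z₀ = {a, b}: all members contain a, or all contain b, or members avoiding
  -- a and b form a triangle with Z₀.
  bound : ∀ {Z₀} → 4 ≤ ∣ Y ∣ → Z₀ ∈ˡ L → length L < ∣ Y ∣
  bound {Z₀} 4≤∣Y∣ Z₀∈L with pairs Z₀∈L
  ... | Z₀⊆Y , ∣Z₀∣≡2 with 0<∣p∣⇒nonempty Z₀ (subst (0 <_) (sym ∣Z₀∣≡2) (s≤s z≤n))
  ...   | a , a∈Z₀ with ∣p∣≡2⇒pair ∣Z₀∣≡2 a∈Z₀
  ...     | b , b≢a , refl
    with star-or-avoided (Z₀⊆Y a∈Z₀) | star-or-avoided (Z₀⊆Y (x∈p⊕q⁺ʳ (b≢a ∘ x∈⁅y⁆⇒x≡y a) (x∈⁅x⁆ b)))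
  ...       | inj₁ done | _         = done
  ...       | inj₂ _    | inj₁ done = done
  ...       | inj₂ (Z₁ , Z₁∈L , a∉Z₁) | inj₂ (Z₂ , Z₂∈L , b∉Z₂) with ∣p∣≡2⇒pair (proj₂ (pairs Z₁∈L)) b∈Z₁
    where
    b∈Z₁ = other-∈ refl a∉Z₁ (intersecting Z₀∈L Z₁∈L)
  ...         | c , c≢b , refl = triangle 4≤∣Y∣ b≢a c≢a c≢b Z₀∈L Z₁∈L (subst (_∈ˡ L) Z₂≡ac Z₂∈L)
    where
    c≢a : c ≢ a
    c≢a refl = a∉Z₁ (x∈p⊕q⁺ʳ (b≢a ∘ sym ∘ x∈⁅y⁆⇒x≡y b) (x∈⁅x⁆ a))
    a∈Z₂ = other-∈ (⊕-comm ⁅ a ⁆ ⁅ b ⁆) b∉Z₂ (intersecting Z₀∈L Z₂∈L)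
    c∈Z₂ = other-∈ refl b∉Z₂ (intersecting Z₁∈L Z₂∈L)
    Z₂≡ac = pair-≡ (proj₂ (pairs Z₂∈L)) a∈Z₂ c∈Z₂ c≢a

intersecting-pairs-bound : ∀ {m} {Y : Subset m} {L : List (Subset m)} → 4 ≤ ∣ Y ∣ → Unique L →
                           (∀ {S} → S ∈ˡ L → S ⊆ Y × ∣ S ∣ ≡ 2) → Intersecting L → length L < ∣ Y ∣
intersecting-pairs-bound {L = []}    4≤∣Y∣ _      _     _            = ≤-trans (s≤s z≤n) 4≤∣Y∣
intersecting-pairs-bound {L = _ ∷ _} 4≤∣Y∣ unique pairs intersecting =
  IntersectingPairs.bound unique pairs intersecting 4≤∣Y∣ (here refl)

-- Singletons get a new point 0, so sets of size 1 or 2 become 2-sets, and two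
-- of them meet as soon as their symmetric difference has at most 2 elements.
pairUp : ∀ {m} → Subset m → Subset (suc m)
pairUp S = (∣ S ∣ ≡ᵇ 1) ∷ S

pairUp-⊆ : ∀ {m} {S X : Subset m} → S ⊆ X → pairUp S ⊆ true ∷ X
pairUp-⊆ S⊆X {F.zero}  _  = here
pairUp-⊆ S⊆X {F.suc x} x∈ = there (S⊆X (drop-there x∈))

∣pairUp∣≡2 : ∀ {m} (S : Subset m) → 0 < ∣ S ∣ → ∣ S ∣ ≤ 2 → ∣ pairUp S ∣ ≡ 2
∣pairUp∣≡2 S 0<∣S∣ ∣S∣≤2 with ∣ S ∣
... | 1 = refl
... | 2 = refl
... | suc (suc (suc _)) with s≤s (s≤s ()) ← ∣S∣≤2

m+n≤2⇒m≡n≡1 : ∀ {m n} → 0 < m → 0 < n → m + n ≤ 2 → m ≡ 1 × n ≡ 1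
m+n≤2⇒m≡n≡1 {suc zero}    {suc zero}    _ _ _                = refl , refl
m+n≤2⇒m≡n≡1 {suc zero}    {suc (suc _)} _ _ (s≤s (s≤s ()))
m+n≤2⇒m≡n≡1 {suc (suc m)} {suc n}       _ _ (s≤s (s≤s m+n<0)) with () ← subst (_≤ 0) (+-suc m n) m+n<0

pairUp-intersect : ∀ {m} {S T : Subset m} → 0 < ∣ S ∣ → 0 < ∣ T ∣ → ∣ S ⊕ T ∣ ≤ 2 →
                   Nonempty (pairUp S ∩ pairUp T)
pairUp-intersect {S = S} {T} 0<∣S∣ 0<∣T∣ ∣S⊕T∣≤2 with nonempty? (S ∩ T)
... | yes (x , x∈S∩T) = F.suc x , there x∈S∩T
... | no  S∩T≡∅ with m+n≤2⇒m≡n≡1 0<∣S∣ 0<∣T∣ (subst (_≤ 2) ∣S⊕T∣≡∣S∣+∣T∣ ∣S⊕T∣≤2)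
  where
  ∣S⊕T∣≡∣S∣+∣T∣ = ∣p⊕q∣≡∣p∣+∣q∣ S T λ x∈S x∈T → S∩T≡∅ (_ , x∈p∩q⁺ (x∈S , x∈T))
...   | ∣S∣≡1 , ∣T∣≡1 rewrite ∣S∣≡1 | ∣T∣≡1 = F.zero , here

-- Enumerating subsets and double counting

subsets : ∀ {m} → Subset m → List (Subset m)
subsets []          = [ [] ]
subsets (true ∷ X)  = map (true ∷_) (subsets X) ++ map (false ∷_) (subsets X)
subsets (false ∷ X) = map (false ∷_) (subsets X)

length-subsets : ∀ {m} (X : Subset m) → length (subsets X) ≡ 2 ^ ∣ X ∣
length-subsets []          = refl
length-subsets (true ∷ X)  = begin
  length (map (true ∷_) (subsets X) ++ map (false ∷_) (subsets X))  ≡⟨ length-++ (map (true ∷_) (subsets X)) ⟩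
  length (map (true ∷_) (subsets X)) + length (map (false ∷_) (subsets X))
    ≡⟨ cong₂ _+_ (length-map (true ∷_) (subsets X)) (length-map (false ∷_) (subsets X)) ⟩
  length (subsets X) + length (subsets X)                            ≡⟨ cong (λ k → k + k) (length-subsets X) ⟩
  2 ^ ∣ X ∣ + 2 ^ ∣ X ∣                                              ≡⟨ cong (2 ^ ∣ X ∣ +_) (+-identityʳ (2 ^ ∣ X ∣)) ⟨
  2 ^ suc ∣ X ∣                                                      ∎
  where open ≡-Reasoning
length-subsets (false ∷ X) = trans (length-map (false ∷_) (subsets X)) (length-subsets X)

∈-subsets⁺ : ∀ {m} {Z X : Subset m} → Z ⊆ X → Z ∈ˡ subsets X
∈-subsets⁺ {Z = []}        {[]}        _   = here refl
∈-subsets⁺ {Z = true ∷ Z}  {true ∷ X}  Z⊆X = ∈-++⁺ˡ (∈-map⁺ (true ∷_) (∈-subsets⁺ (drop-∷-⊆ Z⊆X)))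
∈-subsets⁺ {Z = false ∷ Z} {true ∷ X}  Z⊆X = ∈-++⁺ʳ _ (∈-map⁺ (false ∷_) (∈-subsets⁺ (drop-∷-⊆ Z⊆X)))
∈-subsets⁺ {Z = true ∷ Z}  {false ∷ X} Z⊆X with () ← Z⊆X here
∈-subsets⁺ {Z = false ∷ Z} {false ∷ X} Z⊆X = ∈-map⁺ (false ∷_) (∈-subsets⁺ (drop-∷-⊆ Z⊆X))

∈-subsets⁻ : ∀ {m} {Z : Subset m} X → Z ∈ˡ subsets X → Z ⊆ X
∈-subsets⁻ []          (here refl) ()
∈-subsets⁻ (true ∷ X)  Z∈ with ∈-++⁻ (map (true ∷_) (subsets X)) Z∈
... | inj₁ Z∈trues with ∈-map⁻ (true ∷_) Z∈trues
...   | _ , Z′∈ , refl = in⊆in (∈-subsets⁻ X Z′∈)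
∈-subsets⁻ (true ∷ X)  Z∈ | inj₂ Z∈falses with ∈-map⁻ (false ∷_) Z∈falses
...   | _ , Z′∈ , refl = out⊆ (∈-subsets⁻ X Z′∈)
∈-subsets⁻ (false ∷ X) Z∈ with ∈-map⁻ (false ∷_) Z∈
... | _ , Z′∈ , refl = out⊆ (∈-subsets⁻ X Z′∈)

subsets-unique : ∀ {m} (X : Subset m) → Unique (subsets X)
subsets-unique []          = [] ∷ []
subsets-unique (true ∷ X)  =
  Unique.++⁺ (Unique.map⁺ ∷-injectiveʳ (subsets-unique X)) (Unique.map⁺ ∷-injectiveʳ (subsets-unique X)) disjoint
  where
  disjoint : ∀ {Z} → ¬ (Z ∈ˡ map (true ∷_) (subsets X) × Z ∈ˡ map (false ∷_) (subsets X))
  disjoint (Z∈trues , Z∈falses) with ∈-map⁻ (true ∷_) Z∈trues | ∈-map⁻ (false ∷_) Z∈falses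
  ... | _ , _ , refl | _ , _ , ()
subsets-unique (false ∷ X) = Unique.map⁺ ∷-injectiveʳ (subsets-unique X)

length-filter+length-filter¬ : ∀ {A : Set} {P : A → Set} (P? : Decidable P) xs →
                               length (filter P? xs) + length (filter (¬? ∘ P?) xs) ≡ length xs
length-filter+length-filter¬ P? []       = refl
length-filter+length-filter¬ P? (x ∷ xs) with P? x
... | yes _ = cong suc (length-filter+length-filter¬ P? xs)
... | no  _ = trans (+-suc _ _) (cong suc (length-filter+length-filter¬ P? xs))

length-cartesianProduct : ∀ {A B : Set} (xs : List A) (ys : List B) →
                          length (cartesianProduct xs ys) ≡ length xs * length ys
length-cartesianProduct []       ys = refl
length-cartesianProduct (x ∷ xs) ys =
  trans (length-++ (map (x ,_) ys)) (cong₂ _+_ (length-map (x ,_) ys) (length-cartesianProduct xs ys))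

pigeonhole : ∀ {A B : Set} (f : A → B) (_≟_ : DecidableEquality B) {c} (ys : List B) {xs : List A} →
             (∀ {x} → x ∈ˡ xs → f x ∈ˡ ys) → (∀ y → length (filter (λ x → f x ≟ y) xs) ≤ c) →
             length xs ≤ c * length ys
pigeonhole f _≟_ [] {[]}    _    _ = z≤n
pigeonhole f _≟_ [] {_ ∷ _} into _ with () ← into (here refl)
pigeonhole f _≟_ {c} (y ∷ ys) {xs} into fibres = begin
  length xs                              ≡⟨ length-filter+length-filter¬ (λ x → f x ≟ y) xs ⟨
  length (filter (λ x → f x ≟ y) xs) + length rest
                                         ≤⟨ +-mono-≤ (fibres y) (pigeonhole f _≟_ ys into-ys fibres-rest) ⟩
  c + c * length ys                      ≡⟨ *-suc c (length ys) ⟨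
  c * suc (length ys)                    ∎
  where
  open ≤-Reasoning
  rest = filter (¬? ∘ λ x → f x ≟ y) xs
  into-ys : ∀ {x} → x ∈ˡ rest → f x ∈ˡ ys
  into-ys x∈rest with ∈-filter⁻ (¬? ∘ λ x → f x ≟ y) x∈rest
  ... | x∈xs , fx≢y with into x∈xs
  ...   | here fx≡y     = ⊥-elim (fx≢y fx≡y)
  ...   | there fx∈ys   = fx∈ys
  fibres-rest : ∀ y′ → length (filter (λ x → f x ≟ y′) rest) ≤ c
  fibres-rest y′ =
    ≤-trans (length-mono-≤ (filter⁺ P? P? (λ { refl Px → Px }) (filter-⊆ (¬? ∘ λ x → f x ≟ y) xs))) (fibres y′)
    where P? = λ x → f x ≟ y′

-- A shortest representation of a column

Represents : ∀ {n m} → BinRep n m → Fin m → Subset m → Set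
Represents A t Y = t ∉ Y × colSum A Y ≡ A t

represents? : ∀ {n m} (A : BinRep n m) t → Decidable (Represents A t)
represents? A t Y = ¬? (t ∈? Y) ×-dec ≡-dec Bool._≟_ (colSum A Y) (A t)

nonempty-support : ∀ {n m} {A : BinRep n m} {Z} → colSum A Z ≢ zeroV → Nonempty Z
nonempty-support {A = A} {Z} ΣZ≢0 with nonempty? Z
... | yes Z≢∅ = Z≢∅
... | no  Z≡∅ = ⊥-elim (ΣZ≢0 (trans (cong (colSum A) (Empty-unique Z≡∅)) (colSum-⊥ A)))

module ShortestRepresentation {n m} (A : BinRep n m) {t : Fin m} {X : Subset m}
                              (shortest : MinimumCardinality (Represents A t) X) where

  private
    t∉X = proj₁ (proj₁ shortest)
    ΣX≡At = proj₂ (proj₁ shortest)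

  -- Trading D ⊆ X for E, outside X ∪ {t} and with the same sum, represents A t
  -- again, so minimality of X forces ∣D∣ ≤ ∣E∣.
  exchange : ∀ {D E} → D ⊆ X → (∀ {x} → x ∈ E → x ∉ X) → t ∉ E → colSum A D ≡ colSum A E → ∣ D ∣ ≤ ∣ E ∣
  exchange {D} {E} D⊆X E∩X≡∅ t∉E ΣD≡ΣE = +-cancelˡ-≤ ∣ X ⊕ D ∣ _ _ X-D+D≤X-D+E
    where
    Y = (X ⊕ D) ⊕ E
    t∉Y : t ∉ Y
    t∉Y = x∉p⊕q (x∉p⊕q t∉X (t∉X ∘ D⊆X)) t∉E
    ΣY≡At : colSum A Y ≡ A t
    ΣY≡At = begin
      colSum A ((X ⊕ D) ⊕ E)                  ≡⟨ colSum-⊕ A (X ⊕ D) E ⟩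
      colSum A (X ⊕ D) ⊕ colSum A E           ≡⟨ cong (_⊕ colSum A E) (colSum-⊕ A X D) ⟩
      (colSum A X ⊕ colSum A D) ⊕ colSum A E  ≡⟨ cong₂ (λ u v → (u ⊕ v) ⊕ colSum A E) ΣX≡At ΣD≡ΣE ⟩
      (A t ⊕ colSum A E) ⊕ colSum A E         ≡⟨ [y⊕x]⊕x≡y (colSum A E) (A t) ⟩
      A t                                     ∎
      where open ≡-Reasoning
    X-D+D≤X-D+E : ∣ X ⊕ D ∣ + ∣ D ∣ ≤ ∣ X ⊕ D ∣ + ∣ E ∣
    X-D+D≤X-D+E = begin
      ∣ X ⊕ D ∣ + ∣ D ∣  ≡⟨ ∣p⊕q∣+∣q∣≡∣p∣ X D D⊆X ⟩
      ∣ X ∣              ≤⟨ proj₂ shortest Y (t∉Y , ΣY≡At) ⟩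
      ∣ Y ∣              ≡⟨ ∣p⊕q∣≡∣p∣+∣q∣ (X ⊕ D) E (λ x∈X-D x∈E → E∩X≡∅ x∈E (p⊕q⊆r id D⊆X x∈X-D)) ⟩
      ∣ X ⊕ D ∣ + ∣ E ∣  ∎
      where open ≤-Reasoning

  C : Subset m
  C = X ⊕ ⁅ t ⁆

  t∈C : t ∈ C
  t∈C = x∈p⊕q⁺ʳ t∉X (x∈⁅x⁆ t)

  ∣C∣≡1+∣X∣ : ∣ C ∣ ≡ suc ∣ X ∣
  ∣C∣≡1+∣X∣ = ∣p⊕⁅x⁆∣≡1+∣p∣ t∉X

  sums-injective : ∀ {Z₁ Z₂} → Z₁ ⊆ X → Z₂ ⊆ X → colSum A Z₁ ≡ colSum A Z₂ → Z₁ ≡ Z₂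
  sums-injective {Z₁} {Z₂} Z₁⊆X Z₂⊆X ΣZ₁≡ΣZ₂ = x⊕y≡0⇒x≡y Z₁ Z₂ (∣p∣≡0⇒p≡⊥ (Z₁ ⊕ Z₂) (n≤0⇒n≡0 ∣Z₁⊕Z₂∣≤0))
    where
    ΣZ₁⊕Z₂≡Σ⊥ : colSum A (Z₁ ⊕ Z₂) ≡ colSum A ⊥
    ΣZ₁⊕Z₂≡Σ⊥ = begin
      colSum A (Z₁ ⊕ Z₂)            ≡⟨ colSum-⊕ A Z₁ Z₂ ⟩
      colSum A Z₁ ⊕ colSum A Z₂     ≡⟨ cong (_⊕ colSum A Z₂) ΣZ₁≡ΣZ₂ ⟩
      colSum A Z₂ ⊕ colSum A Z₂     ≡⟨ ⊕-self (colSum A Z₂) ⟩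
      zeroV                         ≡⟨ colSum-⊥ A ⟨
      colSum A ⊥                    ∎
      where open ≡-Reasoning
    ∣Z₁⊕Z₂∣≤0 : ∣ Z₁ ⊕ Z₂ ∣ ≤ 0
    ∣Z₁⊕Z₂∣≤0 = subst (∣ Z₁ ⊕ Z₂ ∣ ≤_) (∣⊥∣≡0 m) (exchange (p⊕q⊆r Z₁⊆X Z₂⊆X) (⊥-elim ∘ ∉⊥) ∉⊥ ΣZ₁⊕Z₂≡Σ⊥)

  circuit : Circuit A C
  circuit = (C , id , (t , t∈C) , ΣC≡0) , minimal
    where
    ΣC≡0 : colSum A C ≡ zeroV
    ΣC≡0 = trans (colSum-⊕ A X ⁅ t ⁆) (trans (cong₂ _⊕_ ΣX≡At (colSum-⁅⁆ A t)) (⊕-self (A t)))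
    minimal : ∀ Y → Y ⊂ C → Independent A Y
    minimal Y Y⊂C (W , W⊆Y , W≢∅ , ΣW≡0) with t ∈? W
    ... | yes t∈W = <⇒≱ ∣W-t∣<∣X∣ (proj₂ shortest (W ⊕ ⁅ t ⁆) (x∉p⊕q′ t∈W (x∈⁅x⁆ t) , ΣW-t≡At))
      where
      ΣW-t≡At : colSum A (W ⊕ ⁅ t ⁆) ≡ A t
      ΣW-t≡At = trans (colSum-⊕ A W ⁅ t ⁆) (trans (cong₂ _⊕_ ΣW≡0 (colSum-⁅⁆ A t)) (⊕-identityˡ (A t)))
      ∣W-t∣<∣X∣ : ∣ W ⊕ ⁅ t ⁆ ∣ < ∣ X ∣
      ∣W-t∣<∣X∣ = ≤-pred (subst₂ _<_ (sym (1+∣p⊕⁅x⁆∣≡∣p∣ t∈W)) ∣C∣≡1+∣X∣ (p⊂q⇒∣p∣<∣q∣ (⊆-⊂-trans W⊆Y Y⊂C)))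
    ... | no t∉W = ∉⊥ (subst (proj₁ W≢∅ ∈_) W≡⊥ (proj₂ W≢∅))
      where
      W⊆X : W ⊆ X
      W⊆X x∈W = x∈p⊕q∧x∉q⇒x∈p (proj₁ Y⊂C (W⊆Y x∈W)) λ x∈⁅t⁆ → t∉W (subst (_∈ W) (x∈⁅y⁆⇒x≡y t x∈⁅t⁆) x∈W)
      W≡⊥ : W ≡ ⊥
      W≡⊥ = sums-injective W⊆X ⊥⊆ (trans ΣW≡0 (sym (colSum-⊥ A)))

  unspanned⇒∉X : ∀ {e} → ¬ Spans A X (A e) → e ∉ X
  unspanned⇒∉X unspanned e∈X = unspanned (spans-column e∈X)

  unspanned⇒≢t : ∀ {e} → ¬ Spans A X (A e) → e ≢ t
  unspanned⇒≢t unspanned refl = unspanned (X , id , ΣX≡At)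

  spanned⇒∈C : Simple A → ∀ {e} → Spans A X (A e) → e ∈ C
  spanned⇒∈C simple {e} (Z , Z⊆X , ΣZ≡Ae) with e ∈? X | e F.≟ t
  ... | yes e∈X | _        = x∈p⊕q⁺ˡ e∈X λ e∈⁅t⁆ → t∉X (subst (_∈ X) (x∈⁅y⁆⇒x≡y t e∈⁅t⁆) e∈X)
  ... | no _    | yes refl = t∈C
  ... | no e∉X  | no e≢t   with nonempty-support (λ ΣZ≡0 → simple⇒nonzero simple e (trans (sym ΣZ≡Ae) ΣZ≡0))
  ...   | x , x∈Z = ⊥-elim (e∉X (subst (_∈ X) x≡e (Z⊆X x∈Z)))
    where
    ∣Z∣≤1 : ∣ Z ∣ ≤ 1
    ∣Z∣≤1 = subst (∣ Z ∣ ≤_) (∣⁅x⁆∣≡1 e)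
      (exchange Z⊆X (λ y∈⁅e⁆ y∈X → e∉X (subst (_∈ X) (x∈⁅y⁆⇒x≡y e y∈⁅e⁆) y∈X)) (e≢t ∘ sym ∘ x∈⁅y⁆⇒x≡y e)
                (trans ΣZ≡Ae (sym (colSum-⁅⁆ A e))))
    Z≡⁅x⁆ : Z ≡ ⁅ x ⁆
    Z≡⁅x⁆ = ∣p∣≡1⇒p≡⁅x⁆ (≤-antisym ∣Z∣≤1 (x∈p⇒0<∣p∣ x∈Z)) x∈Z
    x≡e : x ≡ e
    x≡e = simple⇒injective simple (trans (sym (colSum-⁅⁆ A x)) (trans (cong (colSum A) (sym Z≡⁅x⁆)) ΣZ≡Ae))

  unspanned-pair-bound : ∀ {e f D} → ¬ Spans A X (A e) → ¬ Spans A X (A f) → D ⊆ X →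
                         colSum A D ≡ A e ⊕ A f → ∣ D ∣ ≤ 2
  unspanned-pair-bound {e} {f} {D} unspanned-e unspanned-f D⊆X ΣD≡Ae⊕Af = begin
    ∣ D ∣                      ≤⟨ exchange D⊆X outside-X t∉ef ΣD≡Σef ⟩
    ∣ ⁅ e ⁆ ⊕ ⁅ f ⁆ ∣          ≤⟨ ∣p⊕q∣≤∣p∣+∣q∣ ⁅ e ⁆ ⁅ f ⁆ ⟩
    ∣ ⁅ e ⁆ ∣ + ∣ ⁅ f ⁆ ∣      ≡⟨ cong₂ _+_ (∣⁅x⁆∣≡1 e) (∣⁅x⁆∣≡1 f) ⟩
    2                          ∎
    where
    open ≤-Reasoning
    outside-X : ∀ {x} → x ∈ ⁅ e ⁆ ⊕ ⁅ f ⁆ → x ∉ X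
    outside-X x∈ = Sum.[ (λ { refl → unspanned⇒∉X unspanned-e }) , (λ { refl → unspanned⇒∉X unspanned-f }) ] (x∈⁅y⁆⊕⁅z⁆⁻ x∈)
    t∉ef : t ∉ ⁅ e ⁆ ⊕ ⁅ f ⁆
    t∉ef t∈ = Sum.[ unspanned⇒≢t unspanned-e ∘ sym , unspanned⇒≢t unspanned-f ∘ sym ] (x∈⁅y⁆⊕⁅z⁆⁻ t∈)
    ΣD≡Σef : colSum A D ≡ colSum A (⁅ e ⁆ ⊕ ⁅ f ⁆)
    ΣD≡Σef = trans ΣD≡Ae⊕Af (sym (trans (colSum-⊕ A ⁅ e ⁆ ⁅ f ⁆) (cong₂ _⊕_ (colSum-⁅⁆ A e) (colSum-⁅⁆ A f))))

  Fibre : Vec Bool n → Fin m × Subset m → Set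
  Fibre v (e , Z) = Z ⊆ X × A e ⊕ colSum A Z ≡ v

  fibre-difference : ∀ {v e f Z Z′} → Fibre v (e , Z) → Fibre v (f , Z′) → colSum A (Z ⊕ Z′) ≡ A e ⊕ A f
  fibre-difference {v} {e} {f} {Z} {Z′} (_ , Ae⊕ΣZ≡v) (_ , Af⊕ΣZ′≡v) = sym (x⊕y≡0⇒x≡y _ _ (begin
    (A e ⊕ A f) ⊕ colSum A (Z ⊕ Z′)            ≡⟨ cong ((A e ⊕ A f) ⊕_) (colSum-⊕ A Z Z′) ⟩
    (A e ⊕ A f) ⊕ (colSum A Z ⊕ colSum A Z′)   ≡⟨ ⊕-interchange (A e) (A f) (colSum A Z) (colSum A Z′) ⟩
    (A e ⊕ colSum A Z) ⊕ (A f ⊕ colSum A Z′)   ≡⟨ cong₂ _⊕_ Ae⊕ΣZ≡v Af⊕ΣZ′≡v ⟩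
    v ⊕ v                                      ≡⟨ ⊕-self v ⟩
    zeroV                                      ∎))
    where open ≡-Reasoning

  fibre-column-injective : ∀ {v p q} → Fibre v p → Fibre v q → proj₁ p ≡ proj₁ q → p ≡ q
  fibre-column-injective {p = e , Z} {.e , Z′} fibre@(Z⊆X , _) fibre′@(Z′⊆X , _) refl =
    cong (e ,_) (sums-injective Z⊆X Z′⊆X (x⊕y≡0⇒x≡y _ _
      (trans (sym (colSum-⊕ A Z Z′)) (trans (fibre-difference fibre fibre′) (⊕-self (A e))))))

  fibre-spans : ∀ {v e f Z Z′} → Fibre v (e , Z) → Fibre v (f , Z′) → Spans A X (A e) → Spans A X (A f)
  fibre-spans {e = e} {f} {Z} {Z′} fibre@(Z⊆X , _) fibre′@(Z′⊆X , _) spanned =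
    subst (Spans A X) Σ⊕Ae≡Af (spans-⊕ (Z ⊕ Z′ , p⊕q⊆r Z⊆X Z′⊆X , refl) spanned)
    where
    Σ⊕Ae≡Af : colSum A (Z ⊕ Z′) ⊕ A e ≡ A f
    Σ⊕Ae≡Af = begin
      colSum A (Z ⊕ Z′) ⊕ A e  ≡⟨ cong (_⊕ A e) (fibre-difference fibre fibre′) ⟩
      (A e ⊕ A f) ⊕ A e        ≡⟨ ⊕-comm (A e ⊕ A f) (A e) ⟩
      A e ⊕ (A e ⊕ A f)        ≡⟨ x⊕[x⊕y]≡y (A e) (A f) ⟩
      A f                      ∎
      where open ≡-Reasoning

  module _ (simple : Simple A) {v : Vec Bool n} where

    spanned-coset-bound : ∀ {P e₁ Z₁} → Unique P → (∀ {p} → p ∈ˡ P → Fibre v p) →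
                          (e₁ , Z₁) ∈ˡ P → Spans A X (A e₁) → length P ≤ suc ∣ X ∣
    spanned-coset-bound {P} unique fibre p₁∈P spanned₁ =
      subst₂ _≤_ (length-map (⁅_⁆ ∘ proj₁) P) ∣C∣≡1+∣X∣ (singletons-bound (map⁺-on injective unique) in-C)
      where
      injective : ∀ {p q} → p ∈ˡ P → q ∈ˡ P → ⁅ proj₁ p ⁆ ≡ ⁅ proj₁ q ⁆ → p ≡ q
      injective {p} {q} p∈P q∈P ⁅p⁆≡⁅q⁆ = fibre-column-injective (fibre p∈P) (fibre q∈P)
        (x∈⁅y⁆⇒x≡y (proj₁ q) (subst (proj₁ p ∈_) ⁅p⁆≡⁅q⁆ (x∈⁅x⁆ (proj₁ p))))
      in-C : ∀ {S} → S ∈ˡ map (⁅_⁆ ∘ proj₁) P → S ⊆ C × ∣ S ∣ ≡ 1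
      in-C S∈ with ∈-map⁻ (⁅_⁆ ∘ proj₁) S∈
      ... | (e , Z) , p∈P , refl =
        x∈p⇒⁅x⁆⊆p (spanned⇒∈C simple (fibre-spans (fibre p₁∈P) (fibre p∈P) spanned₁)) , ∣⁅x⁆∣≡1 e

    module Supports {e₁ Z₁} (fibre₁ : Fibre v (e₁ , Z₁)) (unspanned₁ : ¬ Spans A X (A e₁)) where

      W : Fin m × Subset m → Subset m
      W (_ , Z) = Z₁ ⊕ Z

      W⊆X : ∀ {p} → Fibre v p → W p ⊆ X
      W⊆X fibre = p⊕q⊆r (proj₁ fibre₁) (proj₁ fibre)

      ΣW≡Ae₁⊕Ae : ∀ {p} → Fibre v p → colSum A (W p) ≡ A e₁ ⊕ A (proj₁ p)
      ΣW≡Ae₁⊕Ae = fibre-difference fibre₁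

      unspanned : ∀ {p} → Fibre v p → ¬ Spans A X (A (proj₁ p))
      unspanned fibre = unspanned₁ ∘ fibre-spans fibre fibre₁

      0<∣W∣ : ∀ {p} → Fibre v p → (e₁ , Z₁) ≢ p → 0 < ∣ W p ∣
      0<∣W∣ {p} fibre p₁≢p = x∈p⇒0<∣p∣ (proj₂ (nonempty-support {Z = W p} λ ΣW≡0 →
        p₁≢p (fibre-column-injective fibre₁ fibre
          (simple⇒injective simple (x⊕y≡0⇒x≡y _ _ (trans (sym (ΣW≡Ae₁⊕Ae fibre)) ΣW≡0))))))

      ∣W∣≤2 : ∀ {p} → Fibre v p → ∣ W p ∣ ≤ 2
      ∣W∣≤2 fibre = unspanned-pair-bound unspanned₁ (unspanned fibre) (W⊆X fibre) (ΣW≡Ae₁⊕Ae fibre)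

      ∣W⊕W∣≤2 : ∀ {p q} → Fibre v p → Fibre v q → ∣ W p ⊕ W q ∣ ≤ 2
      ∣W⊕W∣≤2 {_ , Z} {_ , Z′} fibre fibre′ =
        unspanned-pair-bound (unspanned fibre) (unspanned fibre′) (p⊕q⊆r (W⊆X fibre) (W⊆X fibre′))
          (trans (cong (colSum A) ([x⊕y]⊕[x⊕z]≡y⊕z Z₁ Z Z′)) (fibre-difference fibre fibre′))

      pairUp-W-injective : ∀ {p q} → Fibre v p → Fibre v q → pairUp (W p) ≡ pairUp (W q) → p ≡ q
      pairUp-W-injective {_ , Z} {_ , Z′} fibre fibre′ ≡pairUp with ⊕-cancelˡ Z₁ Z Z′ (proj₂ (∷-injective ≡pairUp))
      ... | refl = fibre-column-injective fibre fibre′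
        (simple⇒injective simple (⊕-cancelʳ (colSum A Z) _ _ (trans (proj₂ fibre) (sym (proj₂ fibre′)))))

    unspanned-coset-bound : ∀ {P e₁ Z₁} → 3 ≤ ∣ X ∣ → Unique ((e₁ , Z₁) ∷ P) →
                            (∀ {p} → p ∈ˡ (e₁ , Z₁) ∷ P → Fibre v p) → ¬ Spans A X (A e₁) → length P < suc ∣ X ∣
    unspanned-coset-bound {P} 3≤∣X∣ (p₁∉P ∷ unique) fibre unspanned₁ =
      subst (_< suc ∣ X ∣) (length-map (pairUp ∘ W) P)
        (intersecting-pairs-bound (s≤s 3≤∣X∣) (map⁺-on injective unique) pairs intersecting)
      where
      open Supports (fibre (here refl)) unspanned₁
      injective : ∀ {p q} → p ∈ˡ P → q ∈ˡ P → pairUp (W p) ≡ pairUp (W q) → p ≡ q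
      injective p∈P q∈P = pairUp-W-injective (fibre (there p∈P)) (fibre (there q∈P))
      pairs : ∀ {S} → S ∈ˡ map (pairUp ∘ W) P → S ⊆ true ∷ X × ∣ S ∣ ≡ 2
      pairs S∈ with ∈-map⁻ (pairUp ∘ W) S∈
      ... | p , p∈P , refl = pairUp-⊆ (W⊆X (fibre (there p∈P)))
                           , ∣pairUp∣≡2 (W p) (0<∣W∣ (fibre (there p∈P)) (All.lookup p₁∉P p∈P)) (∣W∣≤2 (fibre (there p∈P)))
      intersecting : Intersecting (map (pairUp ∘ W) P)
      intersecting S∈ T∈ with ∈-map⁻ (pairUp ∘ W) S∈ | ∈-map⁻ (pairUp ∘ W) T∈
      ... | p , p∈P , refl | q , q∈P , refl =
        pairUp-intersect (0<∣W∣ (fibre (there p∈P)) (All.lookup p₁∉P p∈P))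
                         (0<∣W∣ (fibre (there q∈P)) (All.lookup p₁∉P q∈P))
                         (∣W⊕W∣≤2 (fibre (there p∈P)) (fibre (there q∈P)))

    coset-bound : 3 ≤ ∣ X ∣ → ∀ {P} → Unique P → (∀ {p} → p ∈ˡ P → Fibre v p) → length P ≤ suc ∣ X ∣
    coset-bound _      {[]}              _      _     = z≤n
    coset-bound 3≤∣X∣ {(e₁ , Z₁) ∷ P} unique fibre with spans? (A e₁)
    ... | yes spanned₁   = spanned-coset-bound unique fibre (here refl) spanned₁
    ... | no  unspanned₁ = unspanned-coset-bound 3≤∣X∣ unique fibre unspanned₁

  column-count : Simple A → 3 ≤ ∣ X ∣ → ∀ {B} → Basis A B → m * 2 ^ ∣ X ∣ ≤ suc ∣ X ∣ * 2 ^ ∣ B ∣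
  column-count simple 3≤∣X∣ {B} basis =
    subst₂ (λ a b → a ≤ suc ∣ X ∣ * b) ∣D∣≡m*2^∣X∣ ∣K∣≡2^∣B∣ (pigeonhole ψ (≡-dec Bool._≟_) K into fibres)
    where
    D = cartesianProduct (allFin m) (subsets X)
    K = map (colSum A) (subsets B)
    ψ : Fin m × Subset m → Vec Bool n
    ψ (e , Z) = A e ⊕ colSum A Z
    ∣D∣≡m*2^∣X∣ : length D ≡ m * 2 ^ ∣ X ∣
    ∣D∣≡m*2^∣X∣ = trans (length-cartesianProduct (allFin m) (subsets X))
                        (cong₂ _*_ (length-tabulate {n = m} id) (length-subsets X))
    ∣K∣≡2^∣B∣ : length K ≡ 2 ^ ∣ B ∣
    ∣K∣≡2^∣B∣ = trans (length-map (colSum A) (subsets B)) (length-subsets B)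
    into : ∀ {d} → d ∈ˡ D → ψ d ∈ˡ K
    into {e , Z} _ with spans-⊕ (basis-spans basis e) (spans-colSum (basis-spans basis) Z)
    ... | S , S⊆B , ΣS≡ψd = subst (_∈ˡ K) ΣS≡ψd (∈-map⁺ (colSum A) (∈-subsets⁺ S⊆B))
    fibres : ∀ v → length (filter (λ d → ≡-dec Bool._≟_ (ψ d) v) D) ≤ suc ∣ X ∣
    fibres v = coset-bound simple 3≤∣X∣
      (Unique.filter⁺ _ (Unique.cartesianProduct⁺ (Unique.allFin⁺ m) (subsets-unique X))) in-fibre
      where
      in-fibre : ∀ {d} → d ∈ˡ filter (λ d → ≡-dec Bool._≟_ (ψ d) v) D → Fibre v d
      in-fibre {e , Z} d∈ with ∈-filter⁻ (λ d → ≡-dec Bool._≟_ (ψ d) v) d∈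
      ... | d∈D , ψd≡v = ∈-subsets⁻ X (proj₂ (∈-cartesianProduct⁻ (allFin m) (subsets X) d∈D)) , ψd≡v

-- Arithmetic

open CommutativeSemigroupProperties *-commutativeSemigroup using (x∙yz≈y∙xz)

[1+w]*2^u≤[1+u]*2^w : ∀ {u w} → u ≤ w → suc w * 2 ^ u ≤ suc u * 2 ^ w
[1+w]*2^u≤[1+u]*2^w {w = zero}  z≤n = ≤-refl
[1+w]*2^u≤[1+u]*2^w {u} {suc w} u≤1+w with m≤n⇒m<n∨m≡n u≤1+w
... | inj₂ refl  = ≤-refl
... | inj₁ u<1+w = begin
  suc (suc w) * 2 ^ u     ≤⟨ *-monoˡ-≤ (2 ^ u) (m≤m+n (2 + w) w) ⟩
  (2 + w + w) * 2 ^ u     ≡⟨ cong (_* 2 ^ u) (2+w+w≡2*[1+w] w) ⟩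
  (2 * suc w) * 2 ^ u     ≡⟨ *-assoc 2 (suc w) (2 ^ u) ⟩
  2 * (suc w * 2 ^ u)     ≤⟨ *-monoʳ-≤ 2 ([1+w]*2^u≤[1+u]*2^w (≤-pred u<1+w)) ⟩
  2 * (suc u * 2 ^ w)     ≡⟨ x∙yz≈y∙xz 2 (suc u) (2 ^ w) ⟩
  suc u * (2 * 2 ^ w)     ∎
  where
  open ≤-Reasoning
  2+w+w≡2*[1+w] : ∀ w → 2 + w + w ≡ 2 * (1 + w)
  2+w+w≡2*[1+w] = solve-∀

count⇒bound : ∀ {m w} r k → m * 2 ^ w ≤ suc w * 2 ^ r → r ∸ k ≤ w → m ≤ 2 ^ k * (r ∸ k + 1)
count⇒bound {m} {w} r k counted r∸k≤w = *-cancelʳ-≤ m (2 ^ k * (r ∸ k + 1)) (2 ^ w) {{m^n≢0 2 w}} (begin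
  m * 2 ^ w                         ≤⟨ counted ⟩
  suc w * 2 ^ r                     ≤⟨ *-monoʳ-≤ (suc w) (^-monoʳ-≤ 2 (m≤n+m∸n r k)) ⟩
  suc w * 2 ^ (k + (r ∸ k))         ≡⟨ cong (suc w *_) (^-distribˡ-+-* 2 k (r ∸ k)) ⟩
  suc w * (2 ^ k * 2 ^ (r ∸ k))     ≡⟨ x∙yz≈y∙xz (suc w) (2 ^ k) (2 ^ (r ∸ k)) ⟩
  2 ^ k * (suc w * 2 ^ (r ∸ k))     ≤⟨ *-monoʳ-≤ (2 ^ k) ([1+w]*2^u≤[1+u]*2^w r∸k≤w) ⟩
  2 ^ k * (suc (r ∸ k) * 2 ^ w)     ≡⟨ rearrange (2 ^ k) (r ∸ k) (2 ^ w) ⟩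
  2 ^ k * (r ∸ k + 1) * 2 ^ w       ∎)
  where
  open ≤-Reasoning
  rearrange : ∀ a u b → a * (suc u * b) ≡ a * (u + 1) * b
  rearrange = solve-∀

3≤r∸k : ∀ r k → 5 ≤ r → 3 * k + 2 ≤ r → 3 ≤ r ∸ k
3≤r∸k r zero    5≤r _      = ≤-trans (s≤s (s≤s (s≤s z≤n))) 5≤r
3≤r∸k r (suc k) _   3k+2≤r =
  m+n≤o⇒m≤o∸n 3 (≤-trans (subst (3 + suc k ≤_) (expand k) (m≤m+n (3 + suc k) (2 * k + 1))) 3k+2≤r)
  where
  expand : ∀ k → 3 + suc k + (2 * k + 1) ≡ 3 * suc k + 2
  expand = solve-∀

theorem1p1 : (r k n m : ℕ) (A : BinRep n m) →
    5 ≤ r → 3 * k + 2 ≤ r →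
    Simple A → HasRank A r → (∀ e → ¬ Coloop A e) →
    (∃ λ t → KLoose A r k t) →
    m ≤ 2 ^ k * (r ∸ k + 1)
theorem1p1 r k n m A 5≤r 3k+2≤r simple ((B , basis) , ∣bases∣≡r) ¬coloop (t , loose) =
  -- ¬ Coloop only yields a basis avoiding t doubly negated; the goal is decidable.
  decidable-stable (m ≤? 2 ^ k * (r ∸ k + 1)) (¬¬-map bound (¬coloop⇒¬¬avoiding-basis (¬coloop t)))
  where
  bound : (∃ λ B₀ → Basis A B₀ × t ∉ B₀) → m ≤ 2 ^ k * (r ∸ k + 1)
  bound (B₀ , basis₀ , t∉B₀) with basis-spans basis₀ t
  ... | Y , Y⊆B₀ , ΣY≡At with minimum-cardinality (represents? A t) ((λ t∈Y → t∉B₀ (Y⊆B₀ t∈Y)) , ΣY≡At)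
  ...   | X , shortest =
    count⇒bound r k (subst (λ b → m * 2 ^ ∣ X ∣ ≤ suc ∣ X ∣ * 2 ^ b) (∣bases∣≡r B basis) counted) r∸k≤∣X∣
    where
    open ShortestRepresentation A shortest
    r∸k≤∣X∣ : r ∸ k ≤ ∣ X ∣
    r∸k≤∣X∣ = ≤-pred (subst (r ∸ k <_) ∣C∣≡1+∣X∣ (loose C circuit t∈C))
    counted : m * 2 ^ ∣ X ∣ ≤ suc ∣ X ∣ * 2 ^ ∣ B ∣
    counted = column-count simple (≤-trans (3≤r∸k r k 5≤r 3k+2≤r) r∸k≤∣X∣) basis
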